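{- Let $s$ be a maximal consistent theory of $\mathbb{LUT}$ and $i$ an agent. Then $\lambda_i(s)=\{\phi\mid K_i\phi\in s\}$ is a consistent theory.
   Context: The language $\mathbf{LUT}$ over a countably infinite set $\mathbf{P}$ of propositional variables and a finite set $\mathbf{I}$ of agents is $\phi::= p\mid\neg\phi\mid(\phi\land\phi)\mid K_i\phi\mid[\phi]\phi\mid U_i\phi$; $\mathbf{EL}$ is the fragment without $[\cdot]$ and $U_i$. Admissible forms: $\eta(\sharp)::=\sharp\mid\phi\to\eta(\sharp)\mid K_i\eta(\sharp)\mid[\phi]\eta(\sharp)$; $\eta(\chi)$ denotes the result of replacing $\sharp$ by $\chi$. The proof system $\mathbb{LUT}$ has axioms: propositional tautologies; $K_i(\phi\to\psi)\to(K_i\phi\to K_i\psi)$; $[\chi](\phi\to\psi)\to([\chi]\phi\to[\chi]\psi)$; $K_i\phi\to\phi$; $[\psi]p\leftrightarrow(\psi\to p)$; $[\psi]\neg\phi\leftrightarrow(\psi\to\neg[\psi]\phi)$; $[\psi](\phi\land\chi)\leftrightarrow([\psi]\phi\land[\psi]\chi)$; $[\psi]K_i\phi\leftrightarrow(\psi\to K_i[\psi]\phi)$; $[\psi][\chi]\phi\leftrightarrow[\psi\land[\psi]\chi]\phi$; $U_i\phi\to\phi\land[\psi]\neg K_i\phi$ for each $\psi\in\mathbf{EL}$; rules: modus ponens (MP), $\phi/K_i\phi$, $\phi/[\chi]\phi$, and RU: from $\eta(\phi\land[\psi]\neg K_i\phi)$ for all $\psi\in\mathbf{EL}$ infer $\eta(U_i\phi)$,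 for any admissible form $\eta$. Let $\mathbf{Thm}$ be its set of theorems. A set of formulas $s$ is a theory if $\mathbf{Thm}\subseteq s$ and $s$ is closed under MP and under RU (for every admissible form $\eta$, formula $\phi$, agent $i$: if $\eta(\phi\land[\psi]\neg K_i\phi)\in s$ for all $\psi\in\mathbf{EL}$ then $\eta(U_i\phi)\in s$). It is consistent if $\bot\notin s$, maximal if for every $\phi$ either $\phi\in s$ or $\neg\phi\in s$, and maximal consistent if both. -}

module Defs where

open import Data.Nat using (ℕ)
open import Data.Fin using (Fin)
open import Data.Bool using (Bool; true; false; not; _∧_)
open import Data.Product using (_×_)
open import Data.Sum using (_⊎_)
open import Relation.Binary.PropositionalEquality using (_≡_)
open import Relation.Nullary using (¬_)

data Form (k : ℕ) : Set where
  var  : ℕ → Form k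
  ~_   : Form k → Form k
  _&_  : Form k → Form k → Form k
  K    : Fin k → Form k → Form k
  [_]_ : Form k → Form k → Form k
  U    : Fin k → Form k → Form k

infixr 6 _&_
infixr 7 ~_
infixr 7 [_]_

module _ {k : ℕ} where

  infixr 4 _⇒_
  infix 3 _⇔_

  _⇒_ : Form k → Form k → Form k
  φ ⇒ ψ = ~ (φ & ~ ψ)

  _⇔_ : Form k → Form k → Form k
  φ ⇔ ψ = (φ ⇒ ψ) & (ψ ⇒ φ)

  ⊥f : Form k
  ⊥f = var 0 & ~ var 0

  data IsEL : Form k → Set where
    el-var : ∀ p → IsEL (var p)
    el-neg : ∀ {φ} → IsEL φ → IsEL (~ φ)
    el-and : ∀ {φ ψ} → IsEL φ → IsEL ψ → IsEL (φ & ψ)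
    el-K   : ∀ {i φ} → IsEL φ → IsEL (K i φ)

  -- Propositional tautologies: true under every assignment of truth values
  -- to the propositionally atomic subformulas (var, K, [·], U).
  eval : (Form k → Bool) → Form k → Bool
  eval v (~ φ)   = not (eval v φ)
  eval v (φ & ψ) = eval v φ ∧ eval v ψ
  eval v φ       = v φ

  Taut : Form k → Set
  Taut φ = (v : Form k → Bool) → eval v φ ≡ true

  data Adm : Set where
    hole : Adm
    imp  : Form k → Adm → Adm
    Kη   : Fin k → Adm → Adm
    boxη : Form k → Adm → Adm

  fill : Adm → Form k → Form k
  fill hole       χ = χ
  fill (imp φ η)  χ = φ ⇒ fill η χ
  fill (Kη i η)   χ = K i (fill η χ)
  fill (boxη φ η) χ = [ φ ] fill η χ

  Ucore : Fin k → Form k → Form k → Form k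
  Ucore i φ ψ = φ & [ ψ ] ~ K i φ

  data Thm : Form k → Set where
    ax-taut : ∀ {φ} → Taut φ → Thm φ
    ax-K    : ∀ i φ ψ → Thm (K i (φ ⇒ ψ) ⇒ (K i φ ⇒ K i ψ))
    ax-box  : ∀ χ φ ψ → Thm ([ χ ] (φ ⇒ ψ) ⇒ ([ χ ] φ ⇒ [ χ ] ψ))
    ax-T    : ∀ i φ → Thm (K i φ ⇒ φ)
    ax-atom : ∀ ψ p → Thm ([ ψ ] var p ⇔ (ψ ⇒ var p))
    ax-neg  : ∀ ψ φ → Thm ([ ψ ] ~ φ ⇔ (ψ ⇒ ~ [ ψ ] φ))
    ax-and  : ∀ ψ φ χ → Thm ([ ψ ] (φ & χ) ⇔ ([ ψ ] φ & [ ψ ] χ))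
    ax-know : ∀ ψ i φ → Thm ([ ψ ] K i φ ⇔ (ψ ⇒ K i ([ ψ ] φ)))
    ax-comp : ∀ ψ χ φ → Thm ([ ψ ] [ χ ] φ ⇔ [ ψ & [ ψ ] χ ] φ)
    ax-U    : ∀ i φ ψ → IsEL ψ → Thm (U i φ ⇒ Ucore i φ ψ)
    r-MP    : ∀ {φ ψ} → Thm (φ ⇒ ψ) → Thm φ → Thm ψ
    r-nec   : ∀ {φ} i → Thm φ → Thm (K i φ)
    r-box   : ∀ {φ} χ → Thm φ → Thm ([ χ ] φ)
    r-RU    : ∀ η i φ → (∀ ψ → IsEL ψ → Thm (fill η (Ucore i φ ψ)))
              → Thm (fill η (U i φ))

  FSet : Set₁
  FSet = Form k → Set

  record IsTheory (s : FSet) : Set where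
    field
      thm⊆   : ∀ {φ} → Thm φ → s φ
      mp-cl  : ∀ {φ ψ} → s (φ ⇒ ψ) → s φ → s ψ
      ru-cl  : ∀ η i φ → (∀ ψ → IsEL ψ → s (fill η (Ucore i φ ψ)))
               → s (fill η (U i φ))

  Consistent : FSet → Set
  Consistent s = ¬ s ⊥f

  Maximal : FSet → Set
  Maximal s = ∀ φ → s φ ⊎ s (~ φ)

  MaxConsTheory : FSet → Set
  MaxConsTheory s = IsTheory s × Consistent s × Maximal s

  lam : Fin k → FSet → FSet
  lam i s φ = s (K i φ)

{-# OPTIONS --safe #-}
module Submission where

open import Defs
open import Data.Nat using (ℕ)
open import Data.Fin using (Fin)
open import Data.Product using (_×_; _,_)

module _ {k : ℕ} {s : FSet {k}} (th : IsTheory s) (i : Fin k) where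
  open IsTheory th

  -- RU-closure transfers because K_i η(♯) is again an admissible form.
  lam-isTheory : IsTheory (lam i s)
  lam-isTheory = record
    { thm⊆  = λ ⊢φ → thm⊆ (r-nec i ⊢φ)
    ; mp-cl = λ {φ} {ψ} Kφ⇒ψ Kφ → mp-cl (mp-cl (thm⊆ (ax-K i φ ψ)) Kφ⇒ψ) Kφ
    ; ru-cl = λ η j φ → ru-cl (Kη i η) j φ
    }

  lam-consistent : Consistent s → Consistent (lam i s)
  lam-consistent con K⊥ = con (mp-cl (thm⊆ (ax-T i ⊥f)) K⊥)

mainTheorem18 : (k : ℕ) (s : Form k → Set) → MaxConsTheory s → (i : Fin k)
    → IsTheory (lam i s) × Consistent (lam i s)
mainTheorem18 k s (th , con , _) i = lam-isTheory th i , lam-consistent th i con
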